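{- Let $R$ be a monotone transit function on a non-empty finite set $V$ satisfying (n3o): for all $x,y,p,q,u,v\in V$, if $R(x,y)\between R(p,q)$ and $R(p,q)\between R(u,v)$, then $R(x,y)\subseteq R(u,v)$, or $R(u,v)\subseteq R(x,y)$, or $R(x,y)\cap R(u,v)=\emptyset$. Then $R$ satisfies (w) and (wp), where (w): for all $x,y,z\in V$, $z\in R(x,y)$ or $y\in R(x,z)$ or $x\in R(y,z)$; (wp): for all $u,v,x,y,p,q\in V$, if $R(u,v)\cap R(x,y)$, $R(u,v)\cap R(p,q)$ and $R(x,y)\cap R(p,q)$ are all non-empty, then $R(p,q)\subseteq R(u,v)\cup R(x,y)$ or $R(u,v)\subseteq R(p,q)\cup R(x,y)$ or $R(x,y)\subseteq R(p,q)\cup R(u,v)$.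
   Context: A transit function on $V$ is a map $R:V\times V\to 2^V$ with $u\in R(u,v)$, $R(u,v)=R(v,u)$, $R(u,u)=\{u\}$ for all $u,v\in V$; it is monotone if $p,q\in R(u,v)$ implies $R(p,q)\subseteq R(u,v)$. Sets $A,B$ overlap, $A\between B$, if $A\cap B$, $A\setminus B$, $B\setminus A$ are all non-empty. -}

module Defs where

open import Data.Nat using (ℕ)
open import Data.Fin using (Fin)
open import Data.Fin.Subset using (Subset; _∈_; _⊆_; _∩_; _∪_; ∁; Nonempty; Empty)
open import Data.Product using (_×_)
open import Data.Sum using (_⊎_)
open import Relation.Binary.PropositionalEquality using (_≡_)
open import Data.Fin.Subset using (⁅_⁆)

record IsTransit {n : ℕ} (R : Fin n → Fin n → Subset n) : Set where
  field
    extensive : ∀ u v → u ∈ R u v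
    symmetric : ∀ u v → R u v ≡ R v u
    idem      : ∀ u → R u u ≡ ⁅ u ⁆

Monotone : {n : ℕ} → (Fin n → Fin n → Subset n) → Set
Monotone R = ∀ u v p q → p ∈ R u v → q ∈ R u v → R p q ⊆ R u v

_≬_ : {n : ℕ} → Subset n → Subset n → Set
A ≬ B = Nonempty (A ∩ B) × Nonempty (A ∩ ∁ B) × Nonempty (B ∩ ∁ A)

N3o : {n : ℕ} → (Fin n → Fin n → Subset n) → Set
N3o R = ∀ x y p q u v → R x y ≬ R p q → R p q ≬ R u v →
          R x y ⊆ R u v ⊎ R u v ⊆ R x y ⊎ Empty (R x y ∩ R u v)

W : {n : ℕ} → (Fin n → Fin n → Subset n) → Set
W R = ∀ x y z → z ∈ R x y ⊎ y ∈ R x z ⊎ x ∈ R y z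

WP : {n : ℕ} → (Fin n → Fin n → Subset n) → Set
WP R = ∀ u v x y p q →
         Nonempty (R u v ∩ R x y) → Nonempty (R u v ∩ R p q) → Nonempty (R x y ∩ R p q) →
         R p q ⊆ R u v ∪ R x y ⊎ R u v ⊆ R p q ∪ R x y ⊎ R x y ⊆ R p q ∪ R u v

-- Both properties come from one configuration forbidden by (n3o): sets A ≬ B ≬ C such
-- that A and C meet but neither contains the other. If (wp) fails, three pairwise
-- meeting sets, none covered by the other two, form such a chain. If (w) fails for
-- x, y, z, the chain is R(x,y) ≬ R(x,z) ≬ R(y,z), with the endpoints x, y, z supplying
-- all the witnesses.
module Submission where

open import Defs
open import Data.Nat using (ℕ; NonZero)
open import Data.Fin using (Fin)
open import Data.Fin.Subset using (Subset; _∈_; _∉_; _⊆_; _∩_; _∪_; ∁; Nonempty; Empty)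
open import Data.Fin.Subset.Properties using (_∈?_; _⊆?_; x∈p∩q⁺; x∉p⇒x∈∁p; x∈p∪q⁺)
open import Data.Fin.Properties using (¬∀⟶∃¬)
open import Data.Product using (_×_; _,_; ∃)
open import Data.Sum using (_⊎_; inj₁; inj₂)
open import Data.Empty using (⊥; ⊥-elim)
open import Function using (_∘_)
open import Relation.Nullary using (¬_; Dec; yes; no; contradiction)
open import Relation.Nullary.Decidable using (_→-dec_)
open import Relation.Binary.PropositionalEquality using (subst)

private
  variable
    n : ℕ
    A B C : Subset n
    a b : Fin n

decide-⊎₃ : ∀ {p q r} {P : Set p} {Q : Set q} {S : Set r} →
            Dec P → Dec Q → Dec S → (¬ P → ¬ Q → ¬ S → ⊥) → P ⊎ Q ⊎ S
decide-⊎₃ (yes p) _       _       _ = inj₁ p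
decide-⊎₃ (no ¬p) (yes q) _       _ = inj₂ (inj₁ q)
decide-⊎₃ (no ¬p) (no ¬q) (yes s) _ = inj₂ (inj₂ s)
decide-⊎₃ (no ¬p) (no ¬q) (no ¬s) absurd = ⊥-elim (absurd ¬p ¬q ¬s)

∈∩-nonempty : a ∈ A → a ∈ B → Nonempty (A ∩ B)
∈∩-nonempty a∈A a∈B = _ , x∈p∩q⁺ (a∈A , a∈B)

∈∖-nonempty : a ∈ A → a ∉ B → Nonempty (A ∩ ∁ B)
∈∖-nonempty a∈A a∉B = ∈∩-nonempty a∈A (x∉p⇒x∈∁p a∉B)

≬-intro : Nonempty (A ∩ B) → a ∈ A → a ∉ B → b ∈ B → b ∉ A → A ≬ B
≬-intro A∩B a∈A a∉B b∈B b∉A = A∩B , ∈∖-nonempty a∈A a∉B , ∈∖-nonempty b∈B b∉A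

⊈⇒∃∉ : ¬ A ⊆ B → ∃ λ a → a ∈ A × a ∉ B
⊈⇒∃∉ {n} {A} {B} A⊈B
  with i , ¬[i∈A⇒i∈B] ← ¬∀⟶∃¬ n _ (λ i → (i ∈? A) →-dec (i ∈? B)) (λ sub → A⊈B (sub _))
  with i ∈? A
... | yes i∈A = i , i∈A , ¬[i∈A⇒i∈B] ∘ (λ i∈B _ → i∈B)
... | no  i∉A = contradiction (λ i∈A → contradiction i∈A i∉A) ¬[i∈A⇒i∈B]

∉∪⁻ : a ∉ A ∪ B → a ∉ A × a ∉ B
∉∪⁻ a∉A∪B = a∉A∪B ∘ x∈p∪q⁺ ∘ inj₁ , a∉A∪B ∘ x∈p∪q⁺ ∘ inj₂

⊈∪⇒∃∉ : ¬ A ⊆ B ∪ C → ∃ λ a → a ∈ A × a ∉ B × a ∉ C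
⊈∪⇒∃∉ A⊈B∪C with a , a∈A , a∉B∪C ← ⊈⇒∃∉ A⊈B∪C with a∉B , a∉C ← ∉∪⁻ a∉B∪C =
  a , a∈A , a∉B , a∉C

OverlapChainSplits : Subset n → Subset n → Subset n → Set
OverlapChainSplits A B C = A ≬ B → B ≬ C → A ⊆ C ⊎ C ⊆ A ⊎ Empty (A ∩ C)

overlapChain-⊥ : OverlapChainSplits A B C → A ≬ B → B ≬ C →
                 a ∈ A → a ∉ C → b ∈ C → b ∉ A → Nonempty (A ∩ C) → ⊥
overlapChain-⊥ splits A≬B B≬C a∈A a∉C b∈C b∉A A∩C with splits A≬B B≬C
... | inj₁ A⊆C        = a∉C (A⊆C a∈A)
... | inj₂ (inj₁ C⊆A) = b∉A (C⊆A b∈C)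
... | inj₂ (inj₂ ∅)   = ∅ A∩C

overlapChain-covered : OverlapChainSplits A B C →
                       Nonempty (A ∩ B) → Nonempty (A ∩ C) → Nonempty (B ∩ C) →
                       C ⊆ A ∪ B ⊎ A ⊆ C ∪ B ⊎ B ⊆ C ∪ A
overlapChain-covered {A = A} {B} {C} splits A∩B A∩C B∩C =
  decide-⊎₃ (C ⊆? A ∪ B) (A ⊆? C ∪ B) (B ⊆? C ∪ A) λ C⊈A∪B A⊈C∪B B⊈C∪A →
    let c , c∈C , c∉A , c∉B = ⊈∪⇒∃∉ C⊈A∪B
        a , a∈A , a∉C , a∉B = ⊈∪⇒∃∉ A⊈C∪B
        b , b∈B , b∉C , b∉A = ⊈∪⇒∃∉ B⊈C∪A
    in overlapChain-⊥ splits (≬-intro A∩B a∈A a∉B b∈B b∉A) (≬-intro B∩C b∈B b∉C c∈C c∉B)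
                      a∈A a∉C c∈C c∉A A∩C

n3o⇒wp : (R : Fin n → Fin n → Subset n) → N3o R → WP R
n3o⇒wp R n3o u v x y p q = overlapChain-covered (n3o u v x y p q)

n3o⇒w : (R : Fin n → Fin n → Subset n) →
        (∀ u v → u ∈ R u v) → (∀ u v → v ∈ R u v) → N3o R → W R
n3o⇒w R left∈ right∈ n3o x y z =
  decide-⊎₃ (z ∈? R x y) (y ∈? R x z) (x ∈? R y z) λ z∉Rxy y∉Rxz x∉Ryz →
    overlapChain-⊥ (n3o x y x z y z)
      (≬-intro (∈∩-nonempty (left∈ x y) (left∈ x z)) (right∈ x y) y∉Rxz (right∈ x z) z∉Rxy)
      (≬-intro (∈∩-nonempty (right∈ x z) (right∈ y z)) (left∈ x z) x∉Ryz (left∈ y z) y∉Rxz)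
      (left∈ x y) x∉Ryz (right∈ y z) z∉Rxy (∈∩-nonempty (right∈ x y) (left∈ y z))

mainTheorem11 : (n : ℕ) → NonZero n → (R : Fin n → Fin n → Subset n) →
    IsTransit R → Monotone R → N3o R → W R × WP R
mainTheorem11 n _ R transit _ n3o = n3o⇒w R extensive right∈ n3o , n3o⇒wp R n3o
  where
  open IsTransit transit
  right∈ : ∀ u v → v ∈ R u v
  right∈ u v = subst (v ∈_) (symmetric v u) (extensive v u)
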